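{- For every Halin graph $H$, $AT(H)\le 4$.
   Context: All graphs are finite and simple. A Halin graph $H=T\cup C_n$ is a plane graph where $T$ is a plane tree with no vertex of degree two and at least one vertex of degree at least three, and $C_n$ is a cycle through all the leaves of $T$, connecting them in the cyclic order determined by the planar drawing of $T$. For a digraph $D$, an Eulerian subdigraph is a spanning subdigraph (possibly disconnected, possibly with no arcs) in which every vertex has indegree equal to outdegree; it is even or odd according to the parity of its number of arcs. $D$ is Alon-Tarsi if the number of even Eulerian subdigraphs of $D$ differs from the number of odd ones. The Alon-Tarsi number $AT(G)$ of a graph $G$ is the smallest integer $k$ such that $G$ has an orientation which is Alon-Tarsi and has maximum outdegree at most $k-1$. -}

module Defs where

open import Data.Nat using (ℕ; zero; suc; _+_; _∸_; _≡ᵇ_; _≤_; _<_; _≥_)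
open import Data.Nat.Properties using ()
open import Data.Bool using (Bool; true; false; _∨_; _∧_; if_then_else_; not)
open import Data.List using (List; []; _∷_; _++_; map; length; upTo; filter)
open import Data.List.Relation.Binary.Pointwise using (Pointwise)
open import Data.Vec using (Vec; []; _∷_)
open import Data.Product using (_×_; _,_; proj₁; proj₂; ∃; ∃-syntax; Σ)
open import Data.Sum using (_⊎_)
open import Relation.Binary.PropositionalEquality using (_≡_; _≢_)

-- Graphs and digraphs on vertex set {0,…,n-1}; an edge/arc is a pair.

Edge : Set
Edge = ℕ × ℕ

swap : Edge → Edge
swap (u , v) = (v , u)

countB : {A : Set} → (A → Bool) → List A → ℕ
countB p [] = 0
countB p (x ∷ xs) = if p x then suc (countB p xs) else countB p xs

deg : List Edge → ℕ → ℕ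
deg E v = countB (λ e → (proj₁ e ≡ᵇ v) ∨ (proj₂ e ≡ᵇ v)) E

outdeg : List Edge → ℕ → ℕ
outdeg D v = countB (λ a → proj₁ a ≡ᵇ v) D

indeg : List Edge → ℕ → ℕ
indeg D v = countB (λ a → proj₂ a ≡ᵇ v) D

-- Plane trees, presented as rooted ordered trees (the order of the
-- children encodes the rotation system of the planar drawing).

data PTree : Set where
  node : List PTree → PTree

-- Vertices are numbered 0,…,size-1 in preorder (root = first label).
mutual
  buildT : ℕ → PTree → ℕ × List Edge
  buildT k (node ts) with buildF k (suc k) ts
  ... | (s , E) = (suc s , E)

  -- buildF p k ts: forest ts, roots attached to parent p, labels from k
  buildF : ℕ → ℕ → List PTree → ℕ × List Edge
  buildF p k [] = (0 , [])
  buildF p k (t ∷ ts) with buildT k t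
  ... | (s₁ , E₁) with buildF p (k + s₁) ts
  ... | (s₂ , E₂) = (s₁ + s₂ , ((p , k) ∷ E₁) ++ E₂)

treeSize : PTree → ℕ
treeSize t = proj₁ (buildT 0 t)

treeEdges : PTree → List Edge
treeEdges t = proj₂ (buildT 0 t)

-- Leaves (degree-1 vertices) in preorder = the cyclic order in which
-- the boundary walk of the planar drawing meets them.
leaves : PTree → List ℕ
leaves t = filter′ (upTo (treeSize t))
  where
  filter′ : List ℕ → List ℕ
  filter′ [] = []
  filter′ (v ∷ vs) = if deg (treeEdges t) v ≡ᵇ 1 then v ∷ filter′ vs else filter′ vs

cycleEdges : List ℕ → List Edge
cycleEdges [] = []
cycleEdges (x ∷ xs) = go x xs
  where
  go : ℕ → List ℕ → List Edge
  go y [] = (y , x) ∷ []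
  go y (z ∷ zs) = (y , z) ∷ go z zs

NoDegreeTwo : PTree → Set
NoDegreeTwo t = ∀ v → v < treeSize t → deg (treeEdges t) v ≢ 2

SomeDegreeAtLeast3 : PTree → Set
SomeDegreeAtLeast3 t = ∃[ v ] (v < treeSize t × deg (treeEdges t) v ≥ 3)

halinSize : PTree → ℕ
halinSize = treeSize

halinEdges : PTree → List Edge
halinEdges t = treeEdges t ++ cycleEdges (leaves t)

IsOrientation : List Edge → List Edge → Set
IsOrientation E D = Pointwise (λ e a → a ≡ e ⊎ a ≡ swap e) E D

allBits : (m : ℕ) → List (Vec Bool m)
allBits zero = [] ∷ []
allBits (suc m) = map (true ∷_) (allBits m) ++ map (false ∷_) (allBits m)

select : (D : List Edge) → Vec Bool (length D) → List Edge
select [] [] = []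
select (a ∷ D) (true ∷ bs) = a ∷ select D bs
select (a ∷ D) (false ∷ bs) = select D bs

isEulerianᵇ : ℕ → List Edge → Bool
isEulerianᵇ n A = allV (upTo n)
  where
  allV : List ℕ → Bool
  allV [] = true
  allV (v ∷ vs) = (outdeg A v ≡ᵇ indeg A v) ∧ allV vs

evenᵇ : ℕ → Bool
evenᵇ zero = true
evenᵇ (suc m) = not (evenᵇ m)

numEvenEulerian : ℕ → List Edge → ℕ
numEvenEulerian n D =
  countB (λ s → isEulerianᵇ n (select D s) ∧ evenᵇ (length (select D s))) (allBits (length D))

numOddEulerian : ℕ → List Edge → ℕ
numOddEulerian n D =
  countB (λ s → isEulerianᵇ n (select D s) ∧ not (evenᵇ (length (select D s)))) (allBits (length D))

AlonTarsi : ℕ → List Edge → Set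
AlonTarsi n D = numEvenEulerian n D ≢ numOddEulerian n D

ATNumberAtMost : ℕ → List Edge → ℕ → Set
ATNumberAtMost n E k =
  ∃[ D ] (IsOrientation E D × AlonTarsi n D × (∀ v → v < n → outdeg D v ≤ k ∸ 1))

{-# OPTIONS --safe #-}
-- Number the vertices of T in preorder and orient every edge of H towards its
-- smaller end.  The orientation is acyclic, so its only Eulerian subdigraph is
-- the empty one, which is even: the orientation is Alon–Tarsi.  The
-- out-neighbours of a vertex are its parent in T and its at most two
-- neighbours on C, so the maximum outdegree is at most 3.
module Submission where

open import Defs
open import Data.Bool using (Bool; true; false; _∧_; not; if_then_else_; T)
open import Data.Bool.ListAction using (all)
open import Data.Bool.Properties using (T-≡; T-∧)
open import Data.Empty using (⊥; ⊥-elim)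
open import Data.List using (List; []; _∷_; _++_; _∷ʳ_; map; zip; upTo; filter; length)
open import Data.List.Extrema.Nat using (argmax; argmax-sel; argmax-all; f[⊥]≤f[argmax]; f[xs]≤f[argmax])
open import Data.List.Membership.Propositional using (_∈_; find)
open import Data.List.Membership.Propositional.Properties
  using (∈-map⁺; ∈-map⁻; ∈-++⁺ˡ; ∈-++⁺ʳ; ∈-++⁻; ∈-upTo⁺; ∈-upTo⁻; ∈-filter⁺; ∈-filter⁻)
open import Data.List.Properties using (foldr-universal; map-++)
open import Data.List.Relation.Binary.Pointwise using ([]; _∷_)
open import Data.List.Relation.Unary.All as All using (All; []; _∷_)
open import Data.List.Relation.Unary.All.Properties using (all⁺; all⁻; ∷ʳ⁺; ++⁺; map⁺; ¬Any⇒All¬)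
open import Data.List.Relation.Unary.AllPairs using ([]; _∷_)
open import Data.List.Relation.Unary.Any using (here; there; any?)
open import Data.List.Relation.Unary.Unique.Propositional using (Unique)
open import Data.List.Relation.Unary.Unique.Propositional.Properties using (upTo⁺; filter⁺)
open import Data.Nat using (ℕ; zero; suc; _+_; _∸_; _≤_; _<_; _≡ᵇ_; _<ᵇ_; _≟_; z≤n; s≤s; z<s)
open import Data.Nat.Properties
  using ( ≡ᵇ⇒≡; ≡⇒≡ᵇ; <ᵇ⇒<; <⇒<ᵇ; +-identityʳ; +-suc; +-comm; +-mono-≤; +-monoʳ-≤
        ; ≤-refl; ≤-reflexive; ≤-trans; ≤-antisym; ≤-pred; <-trans; <-irrefl; ≤-<-trans; <-≤-trans
        ; <⇒≤; <⇒≢; <⇒≱; ≮⇒≥; ≤∧≢⇒<; n≮n; n≤1+n; n<1+n; m≤n⇒m≤1+n; m<n⇒m<1+n; m≤m+n; m<m+n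
        ; n≢0⇒n>0; n<1⇒n≡0; module ≤-Reasoning )
open import Data.Product using (_×_; _,_; proj₁; proj₂; ∃-syntax)
open import Data.Sum using (inj₁; inj₂)
open import Data.Unit using (tt)
open import Data.Vec using (Vec; replicate)
import Data.Vec as Vec
open import Function.Bundles using (Equivalence)
open import Relation.Nullary using (¬_; Dec; yes; no; contradiction; ¬?; _×-dec_; decidable-stable)
open import Relation.Binary.PropositionalEquality
  using (_≡_; _≢_; refl; sym; trans; cong; cong₂; subst; ≢-sym; module ≡-Reasoning)

≡ᵇ-true⇒≡ : ∀ {m n} → (m ≡ᵇ n) ≡ true → m ≡ n
≡ᵇ-true⇒≡ {m} {n} eq = ≡ᵇ⇒≡ m n (Equivalence.from T-≡ eq)

-- Counting

module _ {A : Set} (p : A → Bool) where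

  countB-++ : (xs ys : List A) → countB p (xs ++ ys) ≡ countB p xs + countB p ys
  countB-++ []       ys = refl
  countB-++ (x ∷ xs) ys with p x
  ... | true  = cong suc (countB-++ xs ys)
  ... | false = countB-++ xs ys

  countB-∷ʳ : (x : A) (xs : List A) → countB p (xs ∷ʳ x) ≡ countB p (x ∷ xs)
  countB-∷ʳ x xs = begin
    countB p (xs ∷ʳ x)               ≡⟨ countB-++ xs (x ∷ []) ⟩
    countB p xs + countB p (x ∷ [])  ≡⟨ +-comm (countB p xs) _ ⟩
    countB p (x ∷ []) + countB p xs  ≡⟨ countB-++ (x ∷ []) xs ⟨
    countB p (x ∷ xs)                ∎
    where open ≡-Reasoning

  countB-≡0 : {xs : List A} → All (λ x → ¬ T (p x)) xs → countB p xs ≡ 0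
  countB-≡0 [] = refl
  countB-≡0 {x ∷ xs} (¬px ∷ ¬pxs) with p x
  ... | true  = contradiction tt ¬px
  ... | false = countB-≡0 ¬pxs

  countB-pos⁺ : {x : A} {xs : List A} → x ∈ xs → T (p x) → 0 < countB p xs
  countB-pos⁺ {xs = y ∷ xs} (here refl) py with p y
  ... | true  = z<s
  ... | false = ⊥-elim py
  countB-pos⁺ {xs = y ∷ xs} (there x∈xs) px with p y
  ... | true  = z<s
  ... | false = countB-pos⁺ x∈xs px

  countB-pos⁻ : (xs : List A) → 0 < countB p xs → ∃[ x ] (x ∈ xs × T (p x))
  countB-pos⁻ (x ∷ xs) pos with p x in px
  ... | true  = x , here refl , Equivalence.from T-≡ px
  ... | false with countB-pos⁻ xs pos
  ...   | y , y∈xs , py = y , there y∈xs , py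

countB-map : {A B : Set} (p : B → Bool) (f : A → B) (xs : List A) →
             countB p (map f xs) ≡ countB (λ x → p (f x)) xs
countB-map p f []       = refl
countB-map p f (x ∷ xs) with p (f x)
... | true  = cong suc (countB-map p f xs)
... | false = countB-map p f xs

module _ {A : Set} (p q : A → Bool) where

  countB-cong : {xs : List A} → All (λ x → p x ≡ q x) xs → countB p xs ≡ countB q xs
  countB-cong [] = refl
  countB-cong {x ∷ xs} (px≡qx ∷ eqs) rewrite px≡qx with q x
  ... | true  = cong suc (countB-cong eqs)
  ... | false = countB-cong eqs

  countB-mono : {xs : List A} → All (λ x → T (p x) → T (q x)) xs → countB p xs ≤ countB q xs
  countB-mono [] = z≤n
  countB-mono {x ∷ xs} (p⇒q ∷ imps) with p x | q x
  ... | true  | true  = s≤s (countB-mono imps)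
  ... | true  | false = ⊥-elim (p⇒q tt)
  ... | false | true  = m≤n⇒m≤1+n (countB-mono imps)
  ... | false | false = countB-mono imps

Unique⇒countB≤1 : {xs : List ℕ} → Unique xs → ∀ v → countB (_≡ᵇ v) xs ≤ 1
Unique⇒countB≤1 [] v = z≤n
Unique⇒countB≤1 {x ∷ xs} (x∉xs ∷ unique) v with x ≡ᵇ v in x≡v
... | true  = s≤s (≤-reflexive (countB-≡0 (_≡ᵇ v) (All.map ≢x⇒¬≡v x∉xs)))
  where
  ≢x⇒¬≡v : ∀ {y} → x ≢ y → ¬ T (y ≡ᵇ v)
  ≢x⇒¬≡v x≢y y≡v = x≢y (trans (≡ᵇ-true⇒≡ x≡v) (sym (≡ᵇ⇒≡ _ v y≡v)))
... | false = Unique⇒countB≤1 unique v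

range : ℕ → ℕ → List ℕ
range a zero    = []
range a (suc m) = a ∷ range (suc a) m

range-++ : ∀ a m r → range a m ++ range (a + m) r ≡ range a (m + r)
range-++ a zero    r = cong (λ b → range b r) (+-identityʳ a)
range-++ a (suc m) r =
  cong (a ∷_) (trans (cong (λ b → range (suc a) m ++ range b r) (+-suc a m)) (range-++ (suc a) m r))

∈-range⁻ : ∀ {x} a m → x ∈ range a m → a ≤ x × x < a + m
∈-range⁻     a (suc m) (here refl) = ≤-refl , m<m+n a z<s
∈-range⁻ {x} a (suc m) (there x∈) with ∈-range⁻ (suc a) m x∈
... | a<x , x<1+a+m = <⇒≤ a<x , subst (x <_) (sym (+-suc a m)) x<1+a+m

∈-range⁺ : ∀ {x} a m → a ≤ x → x < a + m → x ∈ range a m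
∈-range⁺ {x} a zero    a≤x x<a+0 = contradiction (≤-<-trans a≤x (subst (x <_) (+-identityʳ a) x<a+0)) (n≮n a)
∈-range⁺ {x} a (suc m) a≤x x<a+1+m with x ≟ a
... | yes refl = here refl
... | no  x≢a  = there (∈-range⁺ (suc a) m (≤∧≢⇒< a≤x (≢-sym x≢a)) (subst (x <_) (+-suc a m) x<a+1+m))

range-unique : ∀ a m → Unique (range a m)
range-unique a zero    = []
range-unique a (suc m) =
  All.tabulate (λ x∈ → <⇒≢ (proj₁ (∈-range⁻ (suc a) m x∈))) ∷ range-unique (suc a) m

Ascending Descending Loopless : Edge → Set
Ascending  e = proj₁ e < proj₂ e
Descending e = proj₂ e < proj₁ e
Loopless   e = proj₁ e ≢ proj₂ e

ProperEdge : ℕ → Edge → Set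
ProperEdge n e = Loopless e × proj₁ e < n × proj₂ e < n

deg-loopless : ∀ {E} → All Loopless E → ∀ v → deg E v ≡ outdeg E v + indeg E v
deg-loopless [] v = refl
deg-loopless {(a , b) ∷ E} (a≢b ∷ loopless) v with a ≡ᵇ v in a≡v | b ≡ᵇ v in b≡v
... | true  | true  = contradiction (trans (≡ᵇ-true⇒≡ a≡v) (sym (≡ᵇ-true⇒≡ b≡v))) a≢b
... | true  | false = cong suc (deg-loopless loopless v)
... | false | true  = trans (cong suc (deg-loopless loopless v)) (sym (+-suc _ _))
... | false | false = deg-loopless loopless v

outdeg≤deg : ∀ {E D} v → IsOrientation E D → outdeg D v ≤ deg E v
outdeg≤deg v [] = z≤n
outdeg≤deg {(a , b) ∷ E} v (inj₁ refl ∷ o) with a ≡ᵇ v | b ≡ᵇ v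
... | true  | true  = s≤s (outdeg≤deg v o)
... | true  | false = s≤s (outdeg≤deg v o)
... | false | true  = m≤n⇒m≤1+n (outdeg≤deg v o)
... | false | false = outdeg≤deg v o
outdeg≤deg {(a , b) ∷ E} v (inj₂ refl ∷ o) with a ≡ᵇ v | b ≡ᵇ v
... | true  | true  = s≤s (outdeg≤deg v o)
... | true  | false = m≤n⇒m≤1+n (outdeg≤deg v o)
... | false | true  = s≤s (outdeg≤deg v o)
... | false | false = outdeg≤deg v o

deg-zip : ∀ xs ys v → deg (zip xs ys) v ≤ countB (_≡ᵇ v) xs + countB (_≡ᵇ v) ys
deg-zip []       ys       v = z≤n
deg-zip (x ∷ xs) []       v = z≤n
deg-zip (x ∷ xs) (y ∷ ys) v with x ≡ᵇ v | y ≡ᵇ v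
... | true  | true  = s≤s (≤-trans (deg-zip xs ys v) (+-monoʳ-≤ (countB (_≡ᵇ v) xs) (n≤1+n _)))
... | true  | false = s≤s (deg-zip xs ys v)
... | false | true  = ≤-trans (s≤s (deg-zip xs ys v)) (≤-reflexive (sym (+-suc (countB (_≡ᵇ v) xs) _)))
... | false | false = deg-zip xs ys v

-- Acyclic orientations

-- `isEulerianᵇ`, `leaves` and `cycleEdges` compute through anonymous
-- where-helpers, which cannot be named.  The meta-variable of `refl {x = _}`
-- is created before the helper's argument is abstracted by `with`, so
-- unification solves it with the helper itself, and `helperOf` retrieves it.
helperOf : {B : Set} {h : B} → h ≡ h → B
helperOf {h = h} _ = h

isEulerianᵇ-all : ∀ n A → isEulerianᵇ n A ≡ all (λ v → outdeg A v ≡ᵇ indeg A v) (upTo n)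
isEulerianᵇ-all n A with refl {A = List ℕ → Bool} {x = _} | upTo n
... | e | vs = trans (foldr-universal (helperOf e) step true refl (λ _ _ → refl) vs)
                     (sym (foldr-universal (all _) step true refl (λ _ _ → refl) vs))
  where
  step : ℕ → Bool → Bool
  step v b = (outdeg A v ≡ᵇ indeg A v) ∧ b

isEulerianᵇ-[] : ∀ n → T (isEulerianᵇ n [])
isEulerianᵇ-[] n = subst T (sym (isEulerianᵇ-all n [])) (all⁻ _ (All.universal (λ _ → tt) (upTo n)))

eulerian⇒balanced : ∀ {n A v} → T (isEulerianᵇ n A) → v < n → outdeg A v ≡ indeg A v
eulerian⇒balanced {n} {A} eulerian v<n =
  ≡ᵇ⇒≡ _ _ (All.lookup (all⁺ _ (upTo n) (subst T (isEulerianᵇ-all n A) eulerian)) (∈-upTo⁺ v<n))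

DescendingBelow : ℕ → Edge → Set
DescendingBelow n a = Descending a × proj₁ a < n

-- At the largest tail m some arc leaves m, while no arc can enter it.
descending-eulerian⇒[] : ∀ {n A} → All (DescendingBelow n) A → T (isEulerianᵇ n A) → A ≡ []
descending-eulerian⇒[] {A = []}    _    _        = refl
descending-eulerian⇒[] {n} {a ∷ A} desc eulerian = ⊥-elim (<-irrefl (sym in≡0) (subst (0 <_) balanced out>0))
  where
  top : Edge
  top = argmax proj₁ a A
  m : ℕ
  m = proj₁ top

  top∈ : top ∈ a ∷ A
  top∈ with argmax-sel proj₁ a A
  ... | inj₁ top≡a = subst (_∈ a ∷ A) (sym top≡a) (here refl)
  ... | inj₂ top∈A = there top∈A

  tails≤m : All (λ b → proj₁ b ≤ m) (a ∷ A)
  tails≤m = f[⊥]≤f[argmax] {f = proj₁} a A ∷ f[xs]≤f[argmax] {f = proj₁} a A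

  out>0 : 0 < outdeg (a ∷ A) m
  out>0 = countB-pos⁺ (λ b → proj₁ b ≡ᵇ m) top∈ (≡⇒≡ᵇ m m refl)

  in≡0 : indeg (a ∷ A) m ≡ 0
  in≡0 = countB-≡0 _ (All.zipWith (λ ((head<tail , _) , tail≤m) head≡m →
                                     <⇒≱ (<-≤-trans head<tail tail≤m) (≤-reflexive (sym (≡ᵇ⇒≡ _ m head≡m))))
                                   (desc , tails≤m))

  balanced : outdeg (a ∷ A) m ≡ indeg (a ∷ A) m
  balanced = eulerian⇒balanced eulerian (argmax-all proj₁ (proj₂ (All.head desc)) (All.map proj₂ (All.tail desc)))

select-All : {P : Edge → Set} (D : List Edge) (s : Vec Bool (length D)) → All P D → All P (select D s)
select-All []      Vec.[]             []        = []
select-All (a ∷ D) (true  Vec.∷ bs) (pa ∷ pD) = pa ∷ select-All D bs pD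
select-All (a ∷ D) (false Vec.∷ bs) (pa ∷ pD) = select-All D bs pD

select-none : (D : List Edge) → select D (replicate (length D) false) ≡ []
select-none []      = refl
select-none (a ∷ D) = select-none D

replicate∈allBits : ∀ m → replicate m false ∈ allBits m
replicate∈allBits zero    = here refl
replicate∈allBits (suc m) =
  ∈-++⁺ʳ (map (true Vec.∷_) (allBits m)) (∈-map⁺ (false Vec.∷_) (replicate∈allBits m))

AlonTarsi-descending : ∀ {n D} → All (DescendingBelow n) D → AlonTarsi n D
AlonTarsi-descending {n} {D} desc even≡odd = <⇒≢ even>0 (sym (trans even≡odd odd≡0))
  where
  even>0 : 0 < numEvenEulerian n D
  even>0 = countB-pos⁺ _ (replicate∈allBits (length D))
    (subst (λ A → T (isEulerianᵇ n A ∧ evenᵇ (length A))) (sym (select-none D))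
           (Equivalence.from T-∧ (isEulerianᵇ-[] n , tt)))

  odd-not-eulerian : ∀ s → ¬ T (isEulerianᵇ n (select D s) ∧ not (evenᵇ (length (select D s))))
  odd-not-eulerian s eulerian∧odd with Equivalence.to T-∧ eulerian∧odd
  ... | eulerian , odd =
    subst (λ A → T (not (evenᵇ (length A)))) (descending-eulerian⇒[] (select-All D s desc) eulerian) odd

  odd≡0 : numOddEulerian n D ≡ 0
  odd≡0 = countB-≡0 _ (All.universal odd-not-eulerian (allBits (length D)))

downward : Edge → Edge
downward (u , v) = if u <ᵇ v then (v , u) else (u , v)

downward-orientation : ∀ E → IsOrientation E (map downward E)
downward-orientation []            = []
downward-orientation ((u , v) ∷ E) with u <ᵇ v
... | true  = inj₂ refl ∷ downward-orientation E
... | false = inj₁ refl ∷ downward-orientation E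

downward-proper : ∀ {n e} → ProperEdge n e → DescendingBelow n (downward e)
downward-proper {e = u , v} (u≢v , u<n , v<n) with u <ᵇ v in u<ᵇv
... | true  = <ᵇ⇒< u v (Equivalence.from T-≡ u<ᵇv) , v<n
... | false = ≤∧≢⇒< (≮⇒≥ (λ u<v → subst T u<ᵇv (<⇒<ᵇ u<v))) (≢-sym u≢v) , u<n

downward-ascending : ∀ {e} → Ascending e → downward e ≡ swap e
downward-ascending {u , v} u<v with u <ᵇ v in u<ᵇv
... | true  = refl
... | false = ⊥-elim (subst T u<ᵇv (<⇒<ᵇ u<v))

ATNumberAtMost-downward : ∀ {n E} k → All (ProperEdge n) E →
                          (∀ v → v < n → outdeg (map downward E) v ≤ k ∸ 1) → ATNumberAtMost n E k
ATNumberAtMost-downward {E = E} k proper outdeg≤ =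
  map downward E , downward-orientation E , AlonTarsi-descending (map⁺ (All.map downward-proper proper)) , outdeg≤

-- Cycles

cycleEdges-zip : ∀ x xs → cycleEdges (x ∷ xs) ≡ zip (x ∷ xs) (xs ∷ʳ x)
cycleEdges-zip x []       = refl
cycleEdges-zip x (z ∷ zs) with refl {A = ℕ → List ℕ → List Edge} {x = _} | z | zs
... | e | y | ys = cong ((x , y) ∷_) (go-zip (helperOf e) (λ _ → refl) (λ _ _ _ → refl) y ys)
  where
  go-zip : (go : ℕ → List ℕ → List Edge) → (∀ y → go y [] ≡ (y , x) ∷ []) →
           (∀ y z zs → go y (z ∷ zs) ≡ (y , z) ∷ go z zs) →
           ∀ y zs → go y zs ≡ zip (y ∷ zs) (zs ∷ʳ x)
  go-zip go go-[] go-∷ y []       = go-[] y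
  go-zip go go-[] go-∷ y (z ∷ zs) = trans (go-∷ y z zs) (cong ((y , z) ∷_) (go-zip go go-[] go-∷ z zs))

zip-All : {P Q : ℕ → Set} {xs ys : List ℕ} → All P xs → All Q ys →
          All (λ e → P (proj₁ e) × Q (proj₂ e)) (zip xs ys)
zip-All []         _          = []
zip-All (_ ∷ _)    []         = []
zip-All (px ∷ pxs) (qy ∷ qys) = (px , qy) ∷ zip-All pxs qys

cycleEdges-All : {P : ℕ → Set} {L : List ℕ} → All P L → All (λ e → P (proj₁ e) × P (proj₂ e)) (cycleEdges L)
cycleEdges-All []                           = []
cycleEdges-All {L = x ∷ xs} all@(px ∷ pxs) =
  subst (All _) (sym (cycleEdges-zip x xs)) (zip-All all (∷ʳ⁺ pxs px))

consecutive-loopless : ∀ {x y zs} → All (_≢ x) (y ∷ zs) → Unique (y ∷ zs) →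
                       All Loopless (zip (y ∷ zs) (zs ∷ʳ x))
consecutive-loopless {zs = []}    (y≢x ∷ []) _                    = y≢x ∷ []
consecutive-loopless {zs = z ∷ _} (_ ∷ ≢x)   ((y≢z ∷ _) ∷ unique) = y≢z ∷ consecutive-loopless ≢x unique

cycleEdges-loopless : ∀ {L} → Unique L → (∀ x → L ≢ x ∷ []) → All Loopless (cycleEdges L)
cycleEdges-loopless {[]}         _             _            = []
cycleEdges-loopless {x ∷ []}     _             notSingleton = contradiction refl (notSingleton x)
cycleEdges-loopless {x ∷ y ∷ zs} (x≢ ∷ unique) _            =
  subst (All Loopless) (sym (cycleEdges-zip x (y ∷ zs)))
        (All.head x≢ ∷ consecutive-loopless (All.map ≢-sym x≢) unique)

cycleEdges-deg≤2 : ∀ {L} → Unique L → ∀ v → deg (cycleEdges L) v ≤ 2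
cycleEdges-deg≤2 {[]}     _      v = z≤n
cycleEdges-deg≤2 {x ∷ xs} unique v = begin
  deg (cycleEdges (x ∷ xs)) v       ≡⟨ cong (λ C → deg C v) (cycleEdges-zip x xs) ⟩
  deg (zip (x ∷ xs) (xs ∷ʳ x)) v    ≤⟨ deg-zip (x ∷ xs) (xs ∷ʳ x) v ⟩
  count (x ∷ xs) + count (xs ∷ʳ x)  ≡⟨ cong (count (x ∷ xs) +_) (countB-∷ʳ (_≡ᵇ v) x xs) ⟩
  count (x ∷ xs) + count (x ∷ xs)   ≤⟨ +-mono-≤ (Unique⇒countB≤1 unique v) (Unique⇒countB≤1 unique v) ⟩
  2                                 ∎
  where
  open ≤-Reasoning
  count : List ℕ → ℕ
  count = countB (_≡ᵇ v)

-- Trees labelled in preorder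

-- The edges of a forest on the vertices k, …, k + s - 1, labelled in
-- preorder, whose roots are children of p.
record IsPreorderForest (p k s : ℕ) (E : List Edge) : Set where
  field
    heads      : map proj₂ E ≡ range k s
    ascending  : All Ascending E
    firstChild : ∀ {a b} → (a , b) ∈ E → a ≢ p → (a , suc a) ∈ E
    firstRoot  : ∀ {b} → (p , b) ∈ E → (p , k) ∈ E

buildF-preorder : ∀ p k ts → p < k → IsPreorderForest p k (proj₁ (buildF p k ts)) (proj₂ (buildF p k ts))
buildF-preorder p k []             p<k = record
  { heads = refl ; ascending = [] ; firstChild = λ () ; firstRoot = λ () }
buildF-preorder p k (node us ∷ ts) p<k = record
  { heads      = cong (k ∷_) heads₁₂
  ; ascending  = p<k ∷ ++⁺ (ascending F₁) (ascending F₂)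
  ; firstChild = firstChild₁₂
  ; firstRoot  = λ _ → here refl
  }
  where
  open IsPreorderForest
  s₁ : ℕ
  s₁ = proj₁ (buildF k (suc k) us)
  E₁ : List Edge
  E₁ = proj₂ (buildF k (suc k) us)
  s₂ : ℕ
  s₂ = proj₁ (buildF p (k + suc s₁) ts)
  E₂ : List Edge
  E₂ = proj₂ (buildF p (k + suc s₁) ts)
  F₁ : IsPreorderForest k (suc k) s₁ E₁
  F₁ = buildF-preorder k (suc k) us (n<1+n k)
  F₂ : IsPreorderForest p (k + suc s₁) s₂ E₂
  F₂ = buildF-preorder p (k + suc s₁) ts (<-≤-trans p<k (m≤m+n k (suc s₁)))

  heads₁₂ : map proj₂ (E₁ ++ E₂) ≡ range (suc k) (s₁ + s₂)
  heads₁₂ = begin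
    map proj₂ (E₁ ++ E₂)                       ≡⟨ map-++ proj₂ E₁ E₂ ⟩
    map proj₂ E₁ ++ map proj₂ E₂               ≡⟨ cong₂ _++_ (heads F₁) (heads F₂) ⟩
    range (suc k) s₁ ++ range (k + suc s₁) s₂  ≡⟨ cong (λ b → range (suc k) s₁ ++ range b s₂) (+-suc k s₁) ⟩
    range (suc k) s₁ ++ range (suc k + s₁) s₂  ≡⟨ range-++ (suc k) s₁ s₂ ⟩
    range (suc k) (s₁ + s₂)                    ∎
    where open ≡-Reasoning

  firstChild₁₂ : ∀ {a b} → (a , b) ∈ (p , k) ∷ E₁ ++ E₂ → a ≢ p → (a , suc a) ∈ (p , k) ∷ E₁ ++ E₂
  firstChild₁₂     (here refl) a≢p = contradiction refl a≢p
  firstChild₁₂ {a} (there ab∈) a≢p with ∈-++⁻ E₁ ab∈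
  ... | inj₂ ab∈E₂ = there (∈-++⁺ʳ E₁ (firstChild F₂ ab∈E₂ a≢p))
  ... | inj₁ ab∈E₁ with a ≟ k
  ...   | yes refl = there (∈-++⁺ˡ (firstRoot F₁ ab∈E₁))
  ...   | no  a≢k  = there (∈-++⁺ˡ (firstChild F₁ ab∈E₁ a≢k))

module PreorderTree {s : ℕ} {E : List Edge} (heads : map proj₂ E ≡ range 1 s) (ascending : All Ascending E) where

  head-bounds : ∀ {e} → e ∈ E → 1 ≤ proj₂ e × proj₂ e < suc s
  head-bounds e∈ = ∈-range⁻ 1 s (subst (_ ∈_) heads (∈-map⁺ proj₂ e∈))

  proper : All (ProperEdge (suc s)) E
  proper = All.tabulate λ e∈ → let tail<head = All.lookup ascending e∈ ; head<n = proj₂ (head-bounds e∈)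
                               in <⇒≢ tail<head , <-trans tail<head head<n , head<n

  indeg≡count : ∀ v → indeg E v ≡ countB (_≡ᵇ v) (range 1 s)
  indeg≡count v = trans (sym (countB-map (_≡ᵇ v) proj₂ E)) (cong (countB (_≡ᵇ v)) heads)

  indeg≤1 : ∀ v → indeg E v ≤ 1
  indeg≤1 v = subst (_≤ 1) (sym (indeg≡count v)) (Unique⇒countB≤1 (range-unique 1 s) v)

  indeg-root : indeg E 0 ≡ 0
  indeg-root = subst (_≡ 0) (sym (indeg≡count 0)) (countB-≡0 _ (All.tabulate 1≤x⇒¬≡0))
    where
    1≤x⇒¬≡0 : ∀ {x} → x ∈ range 1 s → ¬ T (x ≡ᵇ 0)
    1≤x⇒¬≡0 x∈ x≡0 = <⇒≢ (proj₁ (∈-range⁻ 1 s x∈)) (sym (≡ᵇ⇒≡ _ 0 x≡0))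

  indeg-nonroot : ∀ {v} → 1 ≤ v → v < suc s → indeg E v ≡ 1
  indeg-nonroot {v} 1≤v v<n = ≤-antisym (indeg≤1 v)
    (subst (0 <_) (sym (indeg≡count v)) (countB-pos⁺ (_≡ᵇ v) (∈-range⁺ 1 s 1≤v v<n) (≡⇒≡ᵇ v v refl)))

  deg≡ : ∀ v → deg E v ≡ outdeg E v + indeg E v
  deg≡ = deg-loopless (All.map <⇒≢ ascending)

  parent-unique : ∀ {a a′ b} → (a , b) ∈ E → (a′ , b) ∈ E → a ≡ a′
  parent-unique = heads-unique⇒ (subst Unique (sym heads) (range-unique 1 s))
    where
    heads-unique⇒ : ∀ {xs a a′ b} → Unique (map proj₂ xs) → (a , b) ∈ xs → (a′ , b) ∈ xs → a ≡ a′
    heads-unique⇒ _            (here refl) (here refl)  = refl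
    heads-unique⇒ (b∉ ∷ _)     (here refl) (there a′b∈) = contradiction refl (All.lookup b∉ (∈-map⁺ proj₂ a′b∈))
    heads-unique⇒ (b∉ ∷ _)     (there ab∈) (here refl)  = contradiction refl (All.lookup b∉ (∈-map⁺ proj₂ ab∈))
    heads-unique⇒ (_ ∷ unique) (there ab∈) (there a′b∈) = heads-unique⇒ unique ab∈ a′b∈

  root-child : 1 ≤ s → (0 , 1) ∈ E
  root-child 1≤s with ∈-map⁻ proj₂ (subst (1 ∈_) (sym heads) (∈-range⁺ 1 s ≤-refl (s≤s 1≤s)))
  ... | (a , .1) , a1∈ , refl with n<1⇒n≡0 (All.lookup ascending a1∈)
  ...   | refl = a1∈

  leaf⇒1≤s : ∀ {v} → deg E v ≡ 1 → 1 ≤ s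
  leaf⇒1≤s deg≡1 with countB-pos⁻ _ E (subst (0 <_) (sym deg≡1) z<s)
  ... | e , e∈ , _ with head-bounds e∈
  ...   | 1≤head , head<n = ≤-pred (≤-<-trans 1≤head head<n)

  last-leaf : 1 ≤ s → deg E s ≡ 1
  last-leaf 1≤s = trans (deg≡ s) (cong₂ _+_ (countB-≡0 _ (All.tabulate tail≢s)) (indeg-nonroot 1≤s ≤-refl))
    where
    tail≢s : ∀ {e} → e ∈ E → ¬ T (proj₁ e ≡ᵇ s)
    tail≢s e∈ tail≡s =
      <-irrefl (≡ᵇ⇒≡ _ s tail≡s) (<-≤-trans (All.lookup ascending e∈) (≤-pred (proj₂ (head-bounds e∈))))

  root-leaf : 1 ≤ s → All (λ e → proj₁ e ≡ 0 → proj₂ e ≡ 1) E → deg E 0 ≡ 1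
  root-leaf 1≤s only1 = trans (deg≡ 0) (cong₂ _+_ outdeg-root indeg-root)
    where
    outdeg-root : outdeg E 0 ≡ 1
    outdeg-root = ≤-antisym
      (≤-trans (countB-mono _ _ (All.map (λ ⇒1 tail≡0 → ≡⇒≡ᵇ _ 1 (⇒1 (≡ᵇ⇒≡ _ 0 tail≡0))) only1)) (indeg≤1 1))
      (countB-pos⁺ _ (root-child 1≤s) tt)

  module _ (firstChild : ∀ {a b} → (a , b) ∈ E → a ≢ 0 → (a , suc a) ∈ E) where

    -- In preorder, the vertex before a child of the root ends the preceding subtree.
    before-rootChild-leaf : ∀ {u} → (0 , suc u) ∈ E → u ≢ 0 → deg E u ≡ 1
    before-rootChild-leaf {u} c∈ u≢0 = trans (deg≡ u) (cong₂ _+_ (countB-≡0 _ (All.tabulate tail≢u)) indeg≡1)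
      where
      indeg≡1 : indeg E u ≡ 1
      indeg≡1 = indeg-nonroot (n≢0⇒n>0 u≢0) (<-trans (n<1+n u) (proj₂ (head-bounds c∈)))
      tail≢u : ∀ {e} → e ∈ E → ¬ T (proj₁ e ≡ᵇ u)
      tail≢u {a , d} ad∈ tail≡u with ≡ᵇ⇒≡ a u tail≡u
      ... | refl = u≢0 (sym (parent-unique c∈ (firstChild ad∈ u≢0)))

    early-leaf : 1 ≤ s → ∃[ u ] (u < s × deg E u ≡ 1)
    early-leaf 1≤s with any? (λ e → (proj₁ e ≟ 0) ×-dec ¬? (proj₂ e ≟ 1)) E
    ... | no  ¬otherChild = 0 , 1≤s , root-leaf 1≤s (All.map only1 (¬Any⇒All¬ E ¬otherChild))
      where
      only1 : ∀ {e} → ¬ (proj₁ e ≡ 0 × proj₂ e ≢ 1) → proj₁ e ≡ 0 → proj₂ e ≡ 1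
      only1 {e} ¬other tail≡0 = decidable-stable (proj₂ e ≟ 1) (λ head≢1 → ¬other (tail≡0 , head≢1))
    ... | yes otherChild with find otherChild
    ...   | (.0 , c) , c∈ , refl , c≢1 with All.lookup ascending c∈
    ...     | s≤s {n = u} _ with u ≟ 0
    ...       | yes refl = contradiction refl c≢1
    ...       | no  u≢0  = u , ≤-pred (proj₂ (head-bounds c∈)) , before-rootChild-leaf c∈ u≢0

tree∪cycle-AT≤4 : ∀ {s E L} → map proj₂ E ≡ range 1 s → All Ascending E →
                  Unique L → All (_< suc s) L → (∀ x → L ≢ x ∷ []) →
                  ATNumberAtMost (suc s) (E ++ cycleEdges L) 4
tree∪cycle-AT≤4 {s} {E} {L} heads ascending unique bounded notSingleton =
  ATNumberAtMost-downward 4 (++⁺ proper cycle-proper) outdeg≤3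
  where
  open PreorderTree heads ascending
  C : List Edge
  C = cycleEdges L

  cycle-proper : All (ProperEdge (suc s)) C
  cycle-proper = All.zip (cycleEdges-loopless unique notSingleton , cycleEdges-All bounded)

  tree-outdeg : ∀ v → outdeg (map downward E) v ≡ indeg E v
  tree-outdeg v = trans (countB-map (λ a → proj₁ a ≡ᵇ v) downward E)
    (countB-cong _ _ (All.map (λ asc → cong (λ a → proj₁ a ≡ᵇ v) (downward-ascending asc)) ascending))

  outdeg≤3 : ∀ v → v < suc s → outdeg (map downward (E ++ C)) v ≤ 3
  outdeg≤3 v _ = begin
    outdeg (map downward (E ++ C)) v                       ≡⟨ cong (λ D → outdeg D v) (map-++ downward E C) ⟩
    outdeg (map downward E ++ map downward C) v            ≡⟨ countB-++ _ (map downward E) (map downward C) ⟩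
    outdeg (map downward E) v + outdeg (map downward C) v  ≤⟨ +-mono-≤ tree≤1 cycle≤2 ⟩
    3                                                      ∎
    where
    open ≤-Reasoning
    tree≤1 : outdeg (map downward E) v ≤ 1
    tree≤1 = subst (_≤ 1) (sym (tree-outdeg v)) (indeg≤1 v)
    cycle≤2 : outdeg (map downward C) v ≤ 2
    cycle≤2 = ≤-trans (outdeg≤deg v (downward-orientation C)) (cycleEdges-deg≤2 unique v)

leaves-filter : ∀ t → leaves t ≡ filter (λ v → deg (treeEdges t) v ≟ 1) (upTo (treeSize t))
leaves-filter t with refl {A = List ℕ → List ℕ} {x = _} | upTo (treeSize t)
... | e | vs = trans (foldr-universal (helperOf e) step [] refl (λ _ _ → refl) vs)
                     (sym (foldr-universal (filter leaf?) step [] refl filter-step vs))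
  where
  leaf? : ∀ v → Dec (deg (treeEdges t) v ≡ 1)
  leaf? v = deg (treeEdges t) v ≟ 1
  step : ℕ → List ℕ → List ℕ
  step v r = if deg (treeEdges t) v ≡ᵇ 1 then v ∷ r else r
  filter-step : ∀ v vs → filter leaf? (v ∷ vs) ≡ step v (filter leaf? vs)
  filter-step v vs with deg (treeEdges t) v ≡ᵇ 1
  ... | true  = refl
  ... | false = refl

∈-leaves⁻ : ∀ {t v} → v ∈ leaves t → v < treeSize t × deg (treeEdges t) v ≡ 1
∈-leaves⁻ {t} v∈ with ∈-filter⁻ (λ v → deg (treeEdges t) v ≟ 1) (subst (_ ∈_) (leaves-filter t) v∈)
... | v∈upTo , leaf = ∈-upTo⁻ v∈upTo , leaf

∈-leaves⁺ : ∀ {t v} → v < treeSize t → deg (treeEdges t) v ≡ 1 → v ∈ leaves t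
∈-leaves⁺ {t} v<n leaf =
  subst (_ ∈_) (sym (leaves-filter t)) (∈-filter⁺ (λ v → deg (treeEdges t) v ≟ 1) (∈-upTo⁺ v<n) leaf)

leaves-unique : ∀ t → Unique (leaves t)
leaves-unique t = subst Unique (sym (leaves-filter t)) (filter⁺ _ (upTo⁺ (treeSize t)))

leaves-notSingleton : ∀ ts x → leaves (node ts) ≢ x ∷ []
leaves-notSingleton ts x L≡[x] = twoLeaves (early-leaf firstChild 1≤s)
  where
  open IsPreorderForest (buildF-preorder 0 1 ts z<s)
  open PreorderTree heads ascending
  only-x : ∀ {v} → v < treeSize (node ts) → deg (treeEdges (node ts)) v ≡ 1 → v ≡ x
  only-x v<n leaf with subst (_ ∈_) L≡[x] (∈-leaves⁺ {node ts} v<n leaf)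
  ... | here v≡x = v≡x
  1≤s : 1 ≤ proj₁ (buildF 0 1 ts)
  1≤s = leaf⇒1≤s (proj₂ (∈-leaves⁻ {node ts} (subst (x ∈_) (sym L≡[x]) (here refl))))
  twoLeaves : ∃[ u ] (u < proj₁ (buildF 0 1 ts) × deg (treeEdges (node ts)) u ≡ 1) → ⊥
  twoLeaves (u , u<s , u-leaf) =
    <-irrefl (trans (only-x (m<n⇒m<1+n u<s) u-leaf) (sym (only-x ≤-refl (last-leaf 1≤s)))) u<s

lemma3p2 : (T : PTree) → NoDegreeTwo T → SomeDegreeAtLeast3 T →
    ATNumberAtMost (halinSize T) (halinEdges T) 4
lemma3p2 (node ts) _ _ =
  tree∪cycle-AT≤4 heads ascending (leaves-unique (node ts)) leaves-bounded (leaves-notSingleton ts)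
  where
  open IsPreorderForest (buildF-preorder 0 1 ts z<s)
  leaves-bounded : All (_< treeSize (node ts)) (leaves (node ts))
  leaves-bounded = All.tabulate (λ v∈ → proj₁ (∈-leaves⁻ {node ts} v∈))
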